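{- A well-formed $\lambda\alpha$-term $A$ is a $\sigma$-normal form if and only if it is constructed from variables and blocks of the form $W\mathsf{x}_1\circ\cdots\circ W\mathsf{x}_n\circ W\mathsf{z}\circ\mathsf{z}$ ($n\geqslant 0$) by application and abstraction; i.e. $A$ belongs to the set generated by $\mathsf{B}::=W\mathsf{z}\circ\mathsf{z}\mid W\mathsf{x}\circ\mathsf{B}$, $A::=\mathsf{x}\mid\mathsf{B}\mid AA\mid\lambda\mathsf{x}.A$.
   Context: Variables $x,y,z,\ldots$; $\mathsf{x},\mathsf{y},\mathsf{z}$ range over variables. Terms and substitutions of $\lambda\alpha$: $A,B::=\mathsf{x}\mid AB\mid\lambda\mathsf{x}.A\mid S\circ A$, $S::=[B/\mathsf{x}]\mid W\mathsf{x}\mid\{\mathsf{y}\mathsf{x}\}\mid S_{\mathsf{x}}$; $S_1\circ S_2\circ A$ means $S_1\circ(S_2\circ A)$, $S\circ AB$ means $S\circ(AB)$. A context $\Gamma$ is a pair $G,L$ of a finite set $G$ of variables and a finite list $L$ of variables with repetitions allowed; $\Gamma,\mathsf{x}$ denotes $G,(L,\mathsf{x})$; a context with empty list is written $G$. Derivable judgements: $G\vdash\mathsf{x}$ if $\mathsf{x}\in G$; $\Gamma,\mathsf{x}\vdash\mathsf{x}$; from $\Gamma\vdash\mathsf{x}$ infer $\Gamma,\mathsf{y}\vdash\mathsf{x}$ ($\mathsf{x}\neq\mathsf{y}$); from $\Gamma\vdash A$, $\Gamma\vdash B$ infer $\Gamma\vdash AB$; from $\Gamma,\mathsf{x}\vdash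 A$ infer $\Gamma\vdash\lambda\mathsf{x}.A$; from $\Gamma\vdash S\triangleright\Delta$, $\Delta\vdash A$ infer $\Gamma\vdash S\circ A$; from $\Gamma\vdash B$ infer $\Gamma\vdash[B/\mathsf{x}]\triangleright\Gamma,\mathsf{x}$; $\Gamma,\mathsf{x}\vdash W\mathsf{x}\triangleright\Gamma$; $\Gamma,\mathsf{y}\vdash\{\mathsf{y}\mathsf{x}\}\triangleright\Gamma,\mathsf{x}$; from $\Gamma\vdash S\triangleright\Delta$ infer $\Gamma,\mathsf{x}\vdash S_{\mathsf{x}}\triangleright\Delta,\mathsf{x}$. $A$ is well-formed if $\Gamma\vdash A$ is derivable for some $\Gamma$. The system $\sigma$ consists of the rules (applicable in any subterm position): $S\circ AB\to(S\circ A)(S\circ B)$; $S\circ\lambda\mathsf{x}.A\to\lambda\mathsf{x}.S_{\mathsf{x}}\circ A$; $[B/\mathsf{x}]\circ\mathsf{x}\to B$; $[B/\mathsf{x}]\circ W\mathsf{x}\circ A\to A$; $[B/\mathsf{x}]\circ\mathsf{z}\to\mathsf{z}$ ($\mathsf{x}\neq\mathsf{z}$); $\{\mathsf{y}\mathsf{x}\}\circ\mathsf{x}\to\mathsf{y}$; $\{\mathsf{y}\mathsf{x}\}\circ W\mathsf{x}\circ A\to W\mathsf{y}\circ A$; $\{\mathsf{y}\mathsf{x}\}\circ\mathsf{z}\to W\mathsf{y}\circ\mathsf{z}$ ($\mathsf{x}\neq\mathsf{z}$); $S_{\mathsf{x}}\circ\mathsf{x}\to\mathsf{x}$; $S_{\mathsf{x}}\circ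 W\mathsf{x}\circ A\to W\mathsf{x}\circ S\circ A$; $S_{\mathsf{x}}\circ\mathsf{z}\to W\mathsf{x}\circ S\circ\mathsf{z}$ ($\mathsf{x}\neq\mathsf{z}$); $W\mathsf{x}\circ\mathsf{z}\to\mathsf{z}$ ($\mathsf{x}\neq\mathsf{z}$). A $\sigma$-normal form is a term to which no rule of $\sigma$ applies. -}

module Defs where

open import Data.Nat using (ℕ)
open import Data.List using (List; []; _∷_)
open import Data.List.Membership.Propositional using (_∈_)
open import Data.Product using (Σ; ∃; _×_)
open import Relation.Binary.PropositionalEquality using (_≡_; _≢_)
open import Relation.Nullary using (¬_)

Var : Set
Var = ℕ

infixr 5 _∘_
mutual
  data Term : Set where
    var  : Var → Term
    app  : Term → Term → Term
    lam  : Var → Term → Term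
    _∘_  : Subst → Term → Term

  data Subst : Set where
    sub  : Term → Var → Subst
    W    : Var → Subst
    ren  : Var → Var → Subst
    lift : Subst → Var → Subst

-- Contexts Γ = G , L.  G is a finite set (list, membership only matters),
-- L is a finite list with repetitions; L is stored reversed, so that
-- Γ , x  extends L at the head.
record Ctx : Set where
  constructor ctx
  field
    G : List Var
    L : List Var
open Ctx

infixl 4 _,,_
_,,_ : Ctx → Var → Ctx
ctx G L ,, x = ctx G (x ∷ L)

infix 3 _⊢v_ _⊢_ _⊢s_▷_
data _⊢v_ : Ctx → Var → Set where
  v-glob : ∀ {G x} → x ∈ G → ctx G [] ⊢v x
  v-here : ∀ {Γ x} → (Γ ,, x) ⊢v x
  v-weak : ∀ {Γ x y} → x ≢ y → Γ ⊢v x → (Γ ,, y) ⊢v x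

mutual
  data _⊢_ : Ctx → Term → Set where
    t-var : ∀ {Γ x} → Γ ⊢v x → Γ ⊢ var x
    t-app : ∀ {Γ A B} → Γ ⊢ A → Γ ⊢ B → Γ ⊢ app A B
    t-lam : ∀ {Γ x A} → (Γ ,, x) ⊢ A → Γ ⊢ lam x A
    t-sub : ∀ {Γ Δ S A} → Γ ⊢s S ▷ Δ → Δ ⊢ A → Γ ⊢ S ∘ A

  data _⊢s_▷_ : Ctx → Subst → Ctx → Set where
    s-sub  : ∀ {Γ B x} → Γ ⊢ B → Γ ⊢s sub B x ▷ (Γ ,, x)
    s-W    : ∀ {Γ x} → (Γ ,, x) ⊢s W x ▷ Γ
    s-ren  : ∀ {Γ x y} → (Γ ,, y) ⊢s ren y x ▷ (Γ ,, x)
    s-lift : ∀ {Γ Δ S x} → Γ ⊢s S ▷ Δ → (Γ ,, x) ⊢s lift S x ▷ (Δ ,, x)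

WellFormed : Term → Set
WellFormed A = ∃ λ Γ → Γ ⊢ A

infix 3 _⟶_ _⟶s_
mutual
  data _⟶_ : Term → Term → Set where
    r-app    : ∀ {S A B} → S ∘ app A B ⟶ app (S ∘ A) (S ∘ B)
    r-lam    : ∀ {S x A} → S ∘ lam x A ⟶ lam x (lift S x ∘ A)
    r-sub-x  : ∀ {B x} → sub B x ∘ var x ⟶ B
    r-sub-W  : ∀ {B x A} → sub B x ∘ W x ∘ A ⟶ A
    r-sub-z  : ∀ {B x z} → x ≢ z → sub B x ∘ var z ⟶ var z
    r-ren-x  : ∀ {y x} → ren y x ∘ var x ⟶ var y
    r-ren-W  : ∀ {y x A} → ren y x ∘ W x ∘ A ⟶ W y ∘ A
    r-ren-z  : ∀ {y x z} → x ≢ z → ren y x ∘ var z ⟶ W y ∘ var z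
    r-lift-x : ∀ {S x} → lift S x ∘ var x ⟶ var x
    r-lift-W : ∀ {S x A} → lift S x ∘ W x ∘ A ⟶ W x ∘ S ∘ A
    r-lift-z : ∀ {S x z} → x ≢ z → lift S x ∘ var z ⟶ W x ∘ S ∘ var z
    r-W-z    : ∀ {x z} → x ≢ z → W x ∘ var z ⟶ var z
    c-appˡ   : ∀ {A A' B} → A ⟶ A' → app A B ⟶ app A' B
    c-appʳ   : ∀ {A B B'} → B ⟶ B' → app A B ⟶ app A B'
    c-lam    : ∀ {x A A'} → A ⟶ A' → lam x A ⟶ lam x A'
    c-∘ˡ     : ∀ {S S' A} → S ⟶s S' → S ∘ A ⟶ S' ∘ A
    c-∘ʳ     : ∀ {S A A'} → A ⟶ A' → S ∘ A ⟶ S ∘ A'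

  data _⟶s_ : Subst → Subst → Set where
    c-sub  : ∀ {B B' x} → B ⟶ B' → sub B x ⟶s sub B' x
    c-lift : ∀ {S S' x} → S ⟶s S' → lift S x ⟶s lift S' x

σNormal : Term → Set
σNormal A = ¬ (∃ λ A' → A ⟶ A')

data IsBlock : Term → Set where
  blk-base : ∀ {z} → IsBlock (W z ∘ var z)
  blk-W    : ∀ {x B} → IsBlock B → IsBlock (W x ∘ B)

data NFShape : Term → Set where
  nf-var   : ∀ {x} → NFShape (var x)
  nf-block : ∀ {B} → IsBlock B → NFShape B
  nf-app   : ∀ {A B} → NFShape A → NFShape B → NFShape (app A B)
  nf-lam   : ∀ {x A} → NFShape A → NFShape (lam x A)

module Submission where

-- Soundness (NFShape A → σNormal A) needs no typing: in a block
-- W x₁ ∘ ⋯ ∘ W xₙ ∘ W z ∘ z the only rule that could fire is W x ∘ z → z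
-- with x ≢ z, and the innermost W z ∘ z has equal variables.
--
-- Completeness (σNormal A → NFShape A) is by induction on the typing
-- derivation.  Normality passes to subterms, so in the only interesting
-- case S ∘ A the body A already has normal shape.  If A is an
-- application or abstraction, S distributes over it.  Otherwise A is a
-- variable or a block.  A weakening S = W x either completes A to a block
-- or erases a foreign variable; every other ("active") substitution fires
-- on any variable, and on a block W y ∘ C it fires because typing forces
-- the variable it binds to be y.  So a normal S ∘ A is a variable
-- weakened into a block, or a block extended by one more W.

open import Defs
open import Data.Empty using (⊥-elim)
open import Data.Nat using (_≟_)
open import Data.Product using (∃; _,_)
open import Function.Bundles using (_⇔_; mk⇔)
open import Relation.Binary.PropositionalEquality using (refl)
open import Relation.Nullary using (yes; no)

Reducible : Term → Set
Reducible A = ∃ λ A' → A ⟶ A'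

normalInContext : ∀ {A C} → (∀ {A'} → A ⟶ A' → Reducible C) → σNormal C → σNormal A
normalInContext plug normal (_ , step) = normal (plug step)

blockNormal : ∀ {B} → IsBlock B → σNormal B
blockNormal blk-base  (_ , r-W-z z≢z) = z≢z refl
blockNormal blk-base  (_ , c-∘ˡ ())
blockNormal blk-base  (_ , c-∘ʳ ())
blockNormal (blk-W ()) (_ , r-W-z _)
blockNormal (blk-W _) (_ , c-∘ˡ ())
blockNormal (blk-W b) (_ , c-∘ʳ step) = blockNormal b (_ , step)

shapeNormal : ∀ {A} → NFShape A → σNormal A
shapeNormal nf-var       (_ , ())
shapeNormal (nf-block b) = blockNormal b
shapeNormal (nf-app a _) (_ , c-appˡ step) = shapeNormal a (_ , step)
shapeNormal (nf-app _ b) (_ , c-appʳ step) = shapeNormal b (_ , step)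
shapeNormal (nf-lam a)   (_ , c-lam step)  = shapeNormal a (_ , step)

-- The substitutions other than a weakening W x: each of them has a rule
-- for every variable and for a W-headed body of matching type.
data Active : Subst → Set where
  active-sub  : ∀ {B x} → Active (sub B x)
  active-ren  : ∀ {y x} → Active (ren y x)
  active-lift : ∀ {S x} → Active (lift S x)

activeVarRedex : ∀ {S} z → Active S → Reducible (S ∘ var z)
activeVarRedex z (active-sub {x = x}) with x ≟ z
... | yes refl = _ , r-sub-x
... | no x≢z   = _ , r-sub-z x≢z
activeVarRedex z (active-ren {x = x}) with x ≟ z
... | yes refl = _ , r-ren-x
... | no x≢z   = _ , r-ren-z x≢z
activeVarRedex z (active-lift {x = x}) with x ≟ z
... | yes refl = _ , r-lift-x
... | no x≢z   = _ , r-lift-z x≢z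

-- An active substitution fires on a well-typed block: the block W y ∘ C
-- lives in a context ending in y, and the target context of S ends in
-- the variable S binds, so the two agree and S meets W y head-on.
activeBlockRedex : ∀ {Γ Δ S B} → Γ ⊢s S ▷ Δ → Δ ⊢ B → Active S → IsBlock B
                 → Reducible (S ∘ B)
activeBlockRedex (s-sub _)  (t-sub s-W _) _ _ = _ , r-sub-W
activeBlockRedex s-ren      (t-sub s-W _) _ _ = _ , r-ren-W
activeBlockRedex (s-lift _) (t-sub s-W _) _ _ = _ , r-lift-W

activeRedex : ∀ {Γ Δ S A} → Γ ⊢s S ▷ Δ → Δ ⊢ A → Active S → NFShape A
            → Reducible (S ∘ A)
activeRedex _  _  active (nf-var {z}) = activeVarRedex z active
activeRedex tS tA active (nf-block b) = activeBlockRedex tS tA active b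
activeRedex _  _  _      (nf-app _ _) = _ , r-app
activeRedex _  _  _      (nf-lam _)   = _ , r-lam

-- The key step: if S ∘ A is normal and the body A has normal shape, then
-- so does S ∘ A.  Only a weakening can survive, and it turns a variable
-- into a block or lengthens a block.
closureShape : ∀ {Γ Δ} S {A} → Γ ⊢s S ▷ Δ → Δ ⊢ A → NFShape A
             → σNormal (S ∘ A) → NFShape (S ∘ A)
closureShape (W x) _ _ (nf-var {z}) normal with x ≟ z
... | yes refl = nf-block blk-base
... | no x≢z   = ⊥-elim (normal (_ , r-W-z x≢z))
closureShape (W x) _ _ (nf-block b)  _      = nf-block (blk-W b)
closureShape (W x) _ _ (nf-app _ _)  normal = ⊥-elim (normal (_ , r-app))
closureShape (W x) _ _ (nf-lam _)    normal = ⊥-elim (normal (_ , r-lam))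
closureShape (sub B x)  tS tA a normal = ⊥-elim (normal (activeRedex tS tA active-sub a))
closureShape (ren y x)  tS tA a normal = ⊥-elim (normal (activeRedex tS tA active-ren a))
closureShape (lift S x) tS tA a normal = ⊥-elim (normal (activeRedex tS tA active-lift a))

normalShape : ∀ {Γ A} → Γ ⊢ A → σNormal A → NFShape A
normalShape (t-var _) _ = nf-var
normalShape (t-app tA tB) normal =
  nf-app (normalShape tA (normalInContext (λ step → _ , c-appˡ step) normal))
         (normalShape tB (normalInContext (λ step → _ , c-appʳ step) normal))
normalShape (t-lam tA) normal =
  nf-lam (normalShape tA (normalInContext (λ step → _ , c-lam step) normal))
normalShape (t-sub {S = S} tS tA) normal =
  closureShape S tS tA (normalShape tA (normalInContext (λ step → _ , c-∘ʳ step) normal)) normal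

mainTheorem14 : (A : Term) → WellFormed A → (σNormal A ⇔ NFShape A)
mainTheorem14 A (_ , typing) = mk⇔ (normalShape typing) shapeNormal
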